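{- For integers $1\le m\le n$, \[\mathcal{C}_{n+m,m}=\frac{(n+m)(2m+1)}{n(m+1)}\left(\prod_{k=1}^{m}\frac{n+m-k}{k}\right)\left(\prod_{k=m+2}^{n+m}\frac{n+m+k}{k}\right).\]
   Context: A path is a finite sequence of points of $\mathbb{Z}^2$ in which each step is $(1,0)$ or $(0,1)$. For integers $0\le m\le n$, $\mathcal{C}_{n,m}$ denotes the number of paths from $(0,-2m)$ to $(n-m,n-m)$ not crossing the line $y=x$, i.e. all of whose points $(p,q)$ satisfy $q\le p$. An empty product equals $1$. -}

module Defs where

open import Data.Nat as ℕ using (ℕ; zero; suc; _∸_)
open import Data.Integer as ℤ using (ℤ; +_; -_)
import Data.Integer.Properties as ℤP
open import Data.Product using (_×_; _,_)
import Data.Product.Properties as ×P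
open import Data.List using (List; []; _∷_; filter; length; map; foldr; applyUpTo; concatMap)
open import Data.List.Relation.Unary.All using (All; all?)
open import Data.Rational as ℚ using (ℚ; 1ℚ; _/_)
open import Relation.Binary.PropositionalEquality using (_≡_)
open import Relation.Nullary.Decidable using (Dec; _×-dec_)

data Step : Set where
  right up : Step

Point : Set
Point = ℤ × ℤ

move : Point → Step → Point
move (p , q) right = (p ℤ.+ + 1 , q)
move (p , q) up    = (p , q ℤ.+ + 1)

points : Point → List Step → List Point
points a []       = a ∷ []
points a (s ∷ ss) = a ∷ points (move a s) ss

endpoint : Point → List Step → Point
endpoint a []       = a
endpoint a (s ∷ ss) = endpoint (move a s) ss

stepSeqs : ℕ → List (List Step)
stepSeqs zero    = [] ∷ []
stepSeqs (suc L) = concatMap (λ ss → (right ∷ ss) ∷ (up ∷ ss) ∷ []) (stepSeqs L)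

NotAbove : Point → Set
NotAbove (p , q) = q ℤ.≤ p

notAbove? : (x : Point) → Dec (NotAbove x)
notAbove? (p , q) = q ℤ.≤? p

GoodPath : Point → Point → List Step → Set
GoodPath a b ss = (endpoint a ss ≡ b) × All NotAbove (points a ss)

goodPath? : (a b : Point) → (ss : List Step) → Dec (GoodPath a b ss)
goodPath? a b ss = ×P.≡-dec ℤP._≟_ ℤP._≟_ (endpoint a ss) b ×-dec all? notAbove? (points a ss)

-- 𝒞_{n,m}: number of paths from (0,-2m) to (n-m,n-m) not crossing y = x.
-- Every such path has exactly (n-m)+(n+m) = 2n steps, so we enumerate those.
𝒞 : ℕ → ℕ → ℕ
𝒞 n m = length (filter (goodPath? a b) (stepSeqs (2 ℕ.* n)))
  where
  a : Point
  a = (+ 0 , - (+ (2 ℕ.* m)))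
  b : Point
  b = (+ (n ∸ m) , + (n ∸ m))

-- the rational number a/d (d ≥ 1 in all uses; frac a 0 := 0 is a dummy)
frac : ℕ → ℕ → ℚ
frac a zero    = ℚ.0ℚ
frac a (suc d) = (+ a) / suc d

-- ∏_{k=a}^{b} f k  (empty product = 1 when b < a)
∏[_to_] : ℕ → ℕ → (ℕ → ℚ) → ℚ
∏[ a to b ] f = foldr ℚ._*_ 1ℚ (map f (applyUpTo (λ i → a ℕ.+ i) (suc b ∸ a)))

-- Let a be a point at most one step above the diagonal y = x and b a
-- point on or below it. Reflecting a in the line y = x + 1 exchanges right and up steps, so
-- splitting on the first step shows, by induction on the length, that the number of paths
-- from a to b staying weakly below the diagonal plus the number of all paths from the mirror
-- image of a to b is the number of all paths from a to b. For a = (0, -2m) and b = (n, n)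
-- this gives 𝒞_{n+m,m} + C(2n+2m, n+2m+1) = C(2n+2m, n), i.e.
-- 𝒞_{n+m,m} · n! (n+2m+1)! = (2m+1) (2n+2m)!.
-- Both products in the formula are quotients of factorials, and cross-multiplying reduces
-- the claim to this closed form.

module Submission where

open import Defs
open import Data.Nat using (ℕ; _≤_; _+_; _*_; _∸_)
open import Data.Rational using (ℚ) renaming (_*_ to _*ℚ_)
open import Relation.Binary.PropositionalEquality using (_≡_)

import Algebra.Properties.CommutativeSemigroup as CommSemigroupProperties
open import Data.Bool.Base using (true; false)
open import Data.Integer.Base as ℤ using (+_; -_)
import Data.Integer.Properties as ℤP
import Data.Integer.Tactic.RingSolver as ℤ-Ring
open import Data.List.Base
  using (List; []; _∷_; _∷ʳ_; [_]; _++_; length; filter; map; foldr; applyUpTo; concatMap)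
open import Data.List.Properties
  using (length-++; filter-++; filter-accept; filter-reject; filter-none; filter-≐;
         applyUpTo-∷ʳ; map-applyUpTo)
open import Data.List.Relation.Unary.All using (_∷_; []; universal)
open import Data.Nat.Base using (zero; suc; _!; NonZero; z≤n; s≤s)
open import Data.Nat.Combinatorics
  using (_C_; nCn≡1; nCk≡nC[n∸k]; nCk+nC[k+1]≡[n+1]C[k+1]; k![n∸k]!∣n!)
open import Data.Nat.Combinatorics.Specification using (nCk≡n!/k![n-k]!)
open import Data.Nat.DivMod using (m/n*n≡m)
open import Data.Nat.ListAction using (product)
open import Data.Nat.ListAction.Properties using (product-++)
import Data.Nat.Properties as ℕP
import Data.Nat.Tactic.RingSolver as ℕ-Ring
open import Data.Product.Base using (_,_; _×_; proj₁; proj₂)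
import Data.Product.Properties as ×P
open import Data.Rational.Base using (1ℚ; toℚᵘ)
import Data.Rational.Properties as ℚP
open import Data.Rational.Unnormalised.Base as ℚᵘ using (mkℚᵘ; *≡*)
import Data.Rational.Unnormalised.Properties as ℚᵘP
open import Function.Base using (_∘_)
open import Level using (Level)
open import Relation.Binary.Definitions using (DecidableEquality)
open import Relation.Binary.PropositionalEquality
  using (_≢_; refl; sym; trans; cong; cong₂; subst; _≗_; module ≡-Reasoning)
open import Relation.Nullary using (¬_; Dec; yes; no; does; contradiction)
open import Relation.Unary using (Pred; Decidable; _≐_)

open ≡-Reasoning
open CommSemigroupProperties ℕP.+-commutativeSemigroup using () renaming (interchange to +-interchange)
open CommSemigroupProperties ℕP.*-commutativeSemigroup using () renaming (x∙yz≈y∙xz to *-left-comm)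

private
  variable
    ℓ₁ ℓ₂ ℓ₃ ℓ₄ : Level
    A : Set ℓ₁
    B : Set ℓ₂

count : {P : Pred A ℓ₃} → Decidable P → List A → ℕ
count P? = length ∘ filter P?

count-≐ : {P : Pred A ℓ₃} {Q : Pred A ℓ₄} (P? : Decidable P) (Q? : Decidable Q) →
          P ≐ Q → ∀ xs → count P? xs ≡ count Q? xs
count-≐ P? Q? P≐Q xs = cong length (filter-≐ P? Q? P≐Q xs)

count-none : {P : Pred A ℓ₃} (P? : Decidable P) → (∀ x → ¬ P x) → ∀ xs → count P? xs ≡ 0
count-none P? ¬P xs = cong length (filter-none P? (universal ¬P xs))

count-++ : {P : Pred A ℓ₃} (P? : Decidable P) → ∀ xs ys →
           count P? (xs ++ ys) ≡ count P? xs + count P? ys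
count-++ P? xs ys = trans (cong length (filter-++ P? xs ys)) (length-++ (filter P? xs))

count-map : {P : Pred B ℓ₃} (P? : Decidable P) (f : A → B) → ∀ xs →
            count P? (map f xs) ≡ count (P? ∘ f) xs
count-map P? f []       = refl
count-map P? f (x ∷ xs) with does (P? (f x))
... | true  = cong suc (count-map P? f xs)
... | false = count-map P? f xs

count-∷ : {P : Pred B ℓ₃} (P? : Decidable P) (f : A → B) → ∀ x xs →
          count P? [ f x ] + count (P? ∘ f) xs ≡ count (P? ∘ f) (x ∷ xs)
count-∷ P? f x xs = trans (cong (_+ count (P? ∘ f) xs) (count-map P? f [ x ]))
                          (sym (count-++ (P? ∘ f) [ x ] xs))

extensions : List Step → List (List Step)
extensions ss = (right ∷ ss) ∷ (up ∷ ss) ∷ []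

count-extensions : {P : Pred (List Step) ℓ₃} (P? : Decidable P) → ∀ sss →
  count P? (concatMap extensions sss) ≡ count (P? ∘ (right ∷_)) sss + count (P? ∘ (up ∷_)) sss
count-extensions P? []         = refl
count-extensions {P = P} P? (ss ∷ sss) = begin
    count P? (extensions ss ++ concatMap extensions sss)
  ≡⟨ count-++ P? (extensions ss) (concatMap extensions sss) ⟩
    count P? (extensions ss) + count P? (concatMap extensions sss)
  ≡⟨ cong₂ _+_ (count-++ P? [ right ∷ ss ] [ up ∷ ss ]) (count-extensions P? sss) ⟩
    (count P? [ right ∷ ss ] + count P? [ up ∷ ss ]) + (count R? sss + count U? sss)
  ≡⟨ +-interchange (count P? [ right ∷ ss ]) _ _ (count U? sss) ⟩
    (count P? [ right ∷ ss ] + count R? sss) + (count P? [ up ∷ ss ] + count U? sss)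
  ≡⟨ cong₂ _+_ (count-∷ P? (right ∷_) ss sss) (count-∷ P? (up ∷_) ss sss) ⟩
    count R? (ss ∷ sss) + count U? (ss ∷ sss) ∎
  where
  R? : Decidable (P ∘ (right ∷_))
  U? : Decidable (P ∘ (up ∷_))
  R? = P? ∘ (right ∷_)
  U? = P? ∘ (up ∷_)

_≟ᴾ_ : DecidableEquality Point
_≟ᴾ_ = ×P.≡-dec ℤP._≟_ ℤP._≟_

paths : ℕ → Point → Point → ℕ
paths L a b = count (λ ss → endpoint a ss ≟ᴾ b) (stepSeqs L)

goodPaths : ℕ → Point → Point → ℕ
goodPaths L a b = count (goodPath? a b) (stepSeqs L)

paths-suc : ∀ L a b → paths (suc L) a b ≡ paths L (move a right) b + paths L (move a up) b
paths-suc L a b = count-extensions (λ ss → endpoint a ss ≟ᴾ b) (stepSeqs L)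

paths-zero-≡ : ∀ {a b} → a ≡ b → paths 0 a b ≡ 1
paths-zero-≡ {a} {b} a≡b = cong length (filter-accept (λ ss → endpoint a ss ≟ᴾ b) {[]} {[]} a≡b)

paths-zero-≢ : ∀ {a b} → a ≢ b → paths 0 a b ≡ 0
paths-zero-≢ {a} {b} a≢b = cong length (filter-reject (λ ss → endpoint a ss ≟ᴾ b) {[]} {[]} a≢b)

goodPath-start : ∀ {a b} ss → GoodPath a b ss → NotAbove a
goodPath-start []      (_ , a↓ ∷ _) = a↓
goodPath-start (_ ∷ _) (_ , a↓ ∷ _) = a↓

goodPath-∷ : ∀ {a} b s → NotAbove a → (GoodPath a b ∘ (s ∷_)) ≐ GoodPath (move a s) b
goodPath-∷ b s a↓ = (λ { (e , _ ∷ ok) → e , ok }) , (λ { (e , ok) → e , a↓ ∷ ok })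

goodPaths-suc : ∀ L {a} b → NotAbove a →
  goodPaths (suc L) a b ≡ goodPaths L (move a right) b + goodPaths L (move a up) b
goodPaths-suc L {a} b a↓ = trans (count-extensions (goodPath? a b) (stepSeqs L)) (cong₂ _+_
  (count-≐ _ _ (goodPath-∷ b right a↓) (stepSeqs L))
  (count-≐ _ _ (goodPath-∷ b up a↓) (stepSeqs L)))

goodPaths-above : ∀ L {a} b → ¬ NotAbove a → goodPaths L a b ≡ 0
goodPaths-above L {a} b a↑ =
  count-none (goodPath? a b) (λ ss → a↑ ∘ goodPath-start ss) (stepSeqs L)

goodPaths-zero : ∀ {a} b → NotAbove a → goodPaths 0 a b ≡ paths 0 a b
goodPaths-zero {a} b a↓ = by-cases (a ≟ᴾ b)
  where
  by-cases : Dec (a ≡ b) → goodPaths 0 a b ≡ paths 0 a b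
  by-cases (yes a≡b) = trans (cong length (filter-accept (goodPath? a b) {[]} {[]} (a≡b , a↓ ∷ [])))
                             (sym (paths-zero-≡ a≡b))
  by-cases (no a≢b)  = trans (cong length (filter-reject (goodPath? a b) {[]} {[]} (a≢b ∘ proj₁)))
                             (sym (paths-zero-≢ a≢b))

i≤i+1 : ∀ i → i ℤ.≤ i ℤ.+ + 1
i≤i+1 i = ℤP.i≤i+j i (+ 1)

i<i+1 : ∀ i → i ℤ.< i ℤ.+ + 1
i<i+1 i = ℤP.suc[i]≤j⇒i<j (ℤP.≤-reflexive (ℤP.+-comm (+ 1) i))

_≼_ : Point → Point → Set
(p , q) ≼ (p′ , q′) = p ℤ.≤ p′ × q ℤ.≤ q′

≼-refl : ∀ a → a ≼ a
≼-refl (p , q) = ℤP.≤-refl , ℤP.≤-refl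

≼-trans : ∀ {a b c} → a ≼ b → b ≼ c → a ≼ c
≼-trans {_ , _} {_ , _} {_ , _} (h , v) (h′ , v′) = ℤP.≤-trans h h′ , ℤP.≤-trans v v′

≼-move : ∀ a s → a ≼ move a s
≼-move (p , q) right = i≤i+1 p , ℤP.≤-refl
≼-move (p , q) up    = ℤP.≤-refl , i≤i+1 q

≼-endpoint : ∀ a ss → a ≼ endpoint a ss
≼-endpoint a []       = ≼-refl a
≼-endpoint a (s ∷ ss) = ≼-trans {a} (≼-move a s) (≼-endpoint (move a s) ss)

paths-unreachable : ∀ L {a b} → ¬ a ≼ b → paths L a b ≡ 0
paths-unreachable L {a} {b} a⋠b =
  count-none _ (λ ss a⇝b → a⋠b (subst (a ≼_) a⇝b (≼-endpoint a ss))) (stepSeqs L)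

-- The reflection principle

-- Reflection in the line y = x + 1, which every path crossing y = x touches.
reflect : Point → Point
reflect (p , q) = (q ℤ.- + 1 , p ℤ.+ + 1)

i+1-1≡i : ∀ i → (i ℤ.+ + 1) ℤ.- + 1 ≡ i
i+1-1≡i = ℤ-Ring.solve-∀

i-1+1≡i : ∀ i → (i ℤ.- + 1) ℤ.+ + 1 ≡ i
i-1+1≡i = ℤ-Ring.solve-∀

≰⇒i+1≤ : ∀ {i j} → ¬ j ℤ.≤ i → i ℤ.+ + 1 ℤ.≤ j
≰⇒i+1≤ {i} j≰i = ℤP.≤-trans (ℤP.≤-reflexive (ℤP.+-comm i (+ 1))) (ℤP.i<j⇒suc[i]≤j (ℤP.≰⇒> j≰i))

reflect-above : ∀ {p q} → q ℤ.≤ p → ¬ NotAbove (reflect (p , q))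
reflect-above {p} {q} q≤p p+1≤q-1 = ℤP.<-irrefl refl
  (ℤP.<-≤-trans (i<i+1 p) (ℤP.≤-trans p+1≤q-1 (ℤP.≤-trans (ℤP.i-j≤i q (+ 1)) q≤p)))

reflect-diagonal : ∀ {p q} → q ℤ.≤ p ℤ.+ + 1 → ¬ q ℤ.≤ p → reflect (p , q) ≡ (p , q)
reflect-diagonal {p} {q} q≤p+1 q≰p with refl ← ℤP.≤-antisym q≤p+1 (≰⇒i+1≤ q≰p) =
  cong (_, p ℤ.+ + 1) (i+1-1≡i p)

reflect-move-up : ∀ a → reflect (move a up) ≡ move (reflect a) right
reflect-move-up (p , q) = cong (_, p ℤ.+ + 1) (trans (i+1-1≡i q) (sym (i-1+1≡i q)))

-- move (reflect a) up and reflect (move a right) are equal by definition.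
paths-suc-reflect : ∀ L a b →
  paths (suc L) (reflect a) b ≡ paths L (reflect (move a right)) b + paths L (reflect (move a up)) b
paths-suc-reflect L a b = begin
    paths (suc L) (reflect a) b
  ≡⟨ paths-suc L (reflect a) b ⟩
    paths L (move (reflect a) right) b + paths L (reflect (move a right)) b
  ≡⟨ ℕP.+-comm (paths L (move (reflect a) right) b) _ ⟩
    paths L (reflect (move a right)) b + paths L (move (reflect a) right) b
  ≡⟨ cong (λ c → paths L (reflect (move a right)) b + paths L c b) (reflect-move-up a) ⟨
    paths L (reflect (move a right)) b + paths L (reflect (move a up)) b ∎

reflection-principle : ∀ L p q b → q ℤ.≤ p ℤ.+ + 1 → NotAbove b →
  goodPaths L (p , q) b + paths L (reflect (p , q)) b ≡ paths L (p , q) b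
reflection-principle L p q b q≤p+1 b↓ with q ℤP.≤? p
... | no q≰p =
  cong₂ _+_ (goodPaths-above L b q≰p) (cong (λ a → paths L a b) (reflect-diagonal q≤p+1 q≰p))
reflection-principle zero p q b _ b↓ | yes q≤p = begin
    goodPaths 0 (p , q) b + paths 0 (reflect (p , q)) b
  ≡⟨ cong₂ _+_ (goodPaths-zero b q≤p)
               (paths-zero-≢ (λ e → reflect-above q≤p (subst NotAbove (sym e) b↓))) ⟩
    paths 0 (p , q) b + 0
  ≡⟨ ℕP.+-identityʳ _ ⟩
    paths 0 (p , q) b ∎
reflection-principle (suc L) p q b q≤p+1 b↓ | yes q≤p = begin
    goodPaths (suc L) a b + paths (suc L) (reflect a) b
  ≡⟨ cong₂ _+_ (goodPaths-suc L b q≤p) (paths-suc-reflect L a b) ⟩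
    (G a→ + G a↑) + (U (reflect a→) + U (reflect a↑))
  ≡⟨ +-interchange (G a→) _ _ (U (reflect a↑)) ⟩
    (G a→ + U (reflect a→)) + (G a↑ + U (reflect a↑))
  ≡⟨ cong₂ _+_ (reflection-principle L (p ℤ.+ + 1) q b (ℤP.≤-trans q≤p+1 (i≤i+1 _)) b↓)
               (reflection-principle L p (q ℤ.+ + 1) b (ℤP.+-monoˡ-≤ (+ 1) q≤p) b↓) ⟩
    U a→ + U a↑
  ≡⟨ paths-suc L a b ⟨
    paths (suc L) a b ∎
  where
  a a→ a↑ : Point
  a  = (p , q)
  a→ = move a right
  a↑ = move a up
  G U : Point → ℕ
  G c = goodPaths L c b
  U c = paths L c b

-- Unrestricted paths and binomial coefficients

nC0≡1 : ∀ n → n C 0 ≡ 1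
nC0≡1 n = trans (nCk≡nC[n∸k] {k = 0} {n = n} z≤n) (nCn≡1 n)

[n+0]Cn≡1 : ∀ n → (n + 0) C n ≡ 1
[n+0]Cn≡1 n = trans (cong (_C n) (ℕP.+-identityʳ n)) (nCn≡1 n)

i+1+k≡i+[1+k] : ∀ i k → (i ℤ.+ + 1) ℤ.+ + k ≡ i ℤ.+ + suc k
i+1+k≡i+[1+k] i k = ℤP.+-assoc i (+ 1) (+ k)

i+1≰i+0 : ∀ i → ¬ (i ℤ.+ + 1 ℤ.≤ i ℤ.+ + 0)
i+1≰i+0 i i+1≤i+0 = ℤP.<⇒≱ (i<i+1 i) (ℤP.≤-trans i+1≤i+0 (ℤP.≤-reflexive (ℤP.+-identityʳ i)))

paths≡C : ∀ x y {p q p′ q′} → p′ ≡ p ℤ.+ + x → q′ ≡ q ℤ.+ + y →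
  paths (x + y) (p , q) (p′ , q′) ≡ (x + y) C x
paths≡C zero zero {p} {q} refl refl =
  paths-zero-≡ (sym (cong₂ _,_ (ℤP.+-identityʳ p) (ℤP.+-identityʳ q)))
paths≡C zero (suc y) {p} {q} refl refl = begin
    paths (suc y) (p , q) b
  ≡⟨ paths-suc y (p , q) b ⟩
    paths y (p ℤ.+ + 1 , q) b + paths y (p , q ℤ.+ + 1) b
  ≡⟨ cong₂ _+_ (paths-unreachable y (i+1≰i+0 p ∘ proj₁))
               (paths≡C zero y refl (sym (i+1+k≡i+[1+k] q y))) ⟩
    y C 0
  ≡⟨ trans (nC0≡1 y) (sym (nC0≡1 (suc y))) ⟩
    suc y C 0 ∎
  where
  b : Point
  b = (p ℤ.+ + 0 , q ℤ.+ + suc y)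
paths≡C (suc x) zero {p} {q} refl refl = begin
    paths (suc x + 0) (p , q) b
  ≡⟨ paths-suc (x + 0) (p , q) b ⟩
    paths (x + 0) (p ℤ.+ + 1 , q) b + paths (x + 0) (p , q ℤ.+ + 1) b
  ≡⟨ cong₂ _+_ (paths≡C x zero (sym (i+1+k≡i+[1+k] p x)) refl)
               (paths-unreachable (x + 0) (i+1≰i+0 q ∘ proj₂)) ⟩
    (x + 0) C x + 0
  ≡⟨ trans (ℕP.+-identityʳ _) (trans ([n+0]Cn≡1 x) (sym ([n+0]Cn≡1 (suc x)))) ⟩
    (suc x + 0) C suc x ∎
  where
  b : Point
  b = (p ℤ.+ + suc x , q ℤ.+ + 0)
paths≡C (suc x) (suc y) {p} {q} refl refl = begin
    paths (suc x + suc y) (p , q) b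
  ≡⟨ paths-suc (x + suc y) (p , q) b ⟩
    paths (x + suc y) (p ℤ.+ + 1 , q) b + paths (x + suc y) (p , q ℤ.+ + 1) b
  ≡⟨ cong₂ _+_ (paths≡C x (suc y) (sym (i+1+k≡i+[1+k] p x)) refl) up-first ⟩
    (x + suc y) C x + (x + suc y) C suc x
  ≡⟨ nCk+nC[k+1]≡[n+1]C[k+1] (x + suc y) x ⟩
    suc (x + suc y) C suc x ∎
  where
  b : Point
  b = (p ℤ.+ + suc x , q ℤ.+ + suc y)
  up-first : paths (x + suc y) (p , q ℤ.+ + 1) b ≡ (x + suc y) C suc x
  up-first = begin
      paths (x + suc y) (p , q ℤ.+ + 1) b
    ≡⟨ cong (λ L → paths L (p , q ℤ.+ + 1) b) (ℕP.+-suc x y) ⟩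
      paths (suc x + y) (p , q ℤ.+ + 1) b
    ≡⟨ paths≡C (suc x) y refl (sym (i+1+k≡i+[1+k] q y)) ⟩
      (suc x + y) C suc x
    ≡⟨ cong (_C suc x) (ℕP.+-suc x y) ⟨
      (x + suc y) C suc x ∎

[x+y]Cx*[x!*y!]≡[x+y]! : ∀ x y → ((x + y) C x) * (x ! * y !) ≡ (x + y) !
[x+y]Cx*[x!*y!]≡[x+y]! x y = begin
    ((x + y) C x) * (x ! * y !)
  ≡⟨ cong (λ z → ((x + y) C x) * (x ! * z !)) (ℕP.m+n∸m≡n x y) ⟨
    ((x + y) C x) * (x ! * (x + y ∸ x) !)
  ≡⟨ trans (cong (_* (x ! * (x + y ∸ x) !)) (nCk≡n!/k![n-k]! x≤x+y))
           (m/n*n≡m {{ℕP._!*_!≢0 x (x + y ∸ x)}} (k![n∸k]!∣n! x≤x+y)) ⟩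
    (x + y) ! ∎
  where
  x≤x+y : x ≤ x + y
  x≤x+y = ℕP.m≤m+n x y

-- Products of consecutive integers

-- ∏[ a to b ] f unfolds to foldr _*ℚ_ 1ℚ (map f (range a b)).
range : ℕ → ℕ → List ℕ
range a b = applyUpTo (λ i → a + i) (suc b ∸ a)

applyUpTo-cong : {f g : ℕ → A} → f ≗ g → ∀ n → applyUpTo f n ≡ applyUpTo g n
applyUpTo-cong f≗g zero    = refl
applyUpTo-cong f≗g (suc n) = cong₂ _∷_ (f≗g 0) (applyUpTo-cong (f≗g ∘ suc) n)

map-+-range : ∀ c a b → map (λ i → c + i) (range a b) ≡ range (c + a) (c + b)
map-+-range c a b = begin
    map (λ i → c + i) (applyUpTo (λ i → a + i) (suc b ∸ a))
  ≡⟨ map-applyUpTo (λ i → a + i) (λ i → c + i) (suc b ∸ a) ⟩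
    applyUpTo (λ i → c + (a + i)) (suc b ∸ a)
  ≡⟨ applyUpTo-cong (λ i → sym (ℕP.+-assoc c a i)) (suc b ∸ a) ⟩
    applyUpTo (λ i → c + a + i) (suc b ∸ a)
  ≡⟨ cong (applyUpTo (λ i → c + a + i)) (ℕP.[m+n]∸[m+o]≡n∸o c (suc b) a) ⟨
    applyUpTo (λ i → c + a + i) (c + suc b ∸ (c + a))
  ≡⟨ cong (λ t → applyUpTo (λ i → c + a + i) (t ∸ (c + a))) (ℕP.+-suc c b) ⟩
    applyUpTo (λ i → c + a + i) (suc (c + b) ∸ (c + a)) ∎

!*product-ascending : ∀ a len → a ! * product (applyUpTo (λ i → suc a + i) len) ≡ (a + len) !
!*product-ascending a zero      = trans (ℕP.*-identityʳ (a !)) (cong _! (sym (ℕP.+-identityʳ a)))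
!*product-ascending a (suc len) = begin
    a ! * product (applyUpTo (λ i → suc a + i) (suc len))
  ≡⟨ cong (λ ks → a ! * product ks) (applyUpTo-∷ʳ (λ i → suc a + i) len) ⟨
    a ! * product (ks ∷ʳ (suc a + len))
  ≡⟨ cong (a ! *_) (product-++ ks [ suc a + len ]) ⟩
    a ! * (product ks * ((suc a + len) * 1))
  ≡⟨ regroup (a !) (product ks) a len ⟩
    suc (a + len) * (a ! * product ks)
  ≡⟨ cong (suc (a + len) *_) (!*product-ascending a len) ⟩
    suc (a + len) !
  ≡⟨ cong _! (ℕP.+-suc a len) ⟨
    (a + suc len) ! ∎
  where
  ks : List ℕ
  ks = applyUpTo (λ i → suc a + i) len
  regroup : ∀ f p a l → f * (p * ((1 + a + l) * 1)) ≡ (1 + (a + l)) * (f * p)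
  regroup = ℕ-Ring.solve-∀

!*product-descending : ∀ a len → a ! * product (applyUpTo ((a + len) ∸_) len) ≡ (a + len) !
!*product-descending a zero = trans (ℕP.*-identityʳ (a !)) (cong _! (sym (ℕP.+-identityʳ a)))
!*product-descending a (suc len) rewrite ℕP.+-suc a len = begin
    a ! * (suc (a + len) * product (applyUpTo ((a + len) ∸_) len))
  ≡⟨ *-left-comm (a !) (suc (a + len)) _ ⟩
    suc (a + len) * (a ! * product (applyUpTo ((a + len) ∸_) len))
  ≡⟨ cong (suc (a + len) *_) (!*product-descending a len) ⟩
    suc (a + len) ! ∎

product-range : ∀ {a b} → a ≤ b → a ! * product (range (suc a) b) ≡ b !
product-range {a} {b} a≤b = trans (!*product-ascending a (b ∸ a)) (cong _! (ℕP.m+[n∸m]≡n a≤b))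

toℚᵘ-frac : ∀ a d → toℚᵘ (frac a (suc d)) ℚᵘ.≃ mkℚᵘ (+ a) d
toℚᵘ-frac a d = ℚP.toℚᵘ-fromℚᵘ (mkℚᵘ (+ a) d)

frac-* : ∀ a b d e → frac a d *ℚ frac b e ≡ frac (a * b) (d * e)
frac-* a b zero    e       = ℚP.*-zeroˡ (frac b e)
frac-* a b (suc d) zero    =
  trans (ℚP.*-zeroʳ (frac a (suc d))) (cong (frac (a * b)) (sym (ℕP.*-zeroʳ d)))
frac-* a b (suc d) (suc e) = ℚP.toℚᵘ-injective
  (ℚᵘP.≃-trans (ℚP.toℚᵘ-homo-* (frac a (suc d)) (frac b (suc e)))
  (ℚᵘP.≃-trans (ℚᵘP.*-cong (toℚᵘ-frac a d) (toℚᵘ-frac b e))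
  (ℚᵘP.≃-trans (ℚᵘP.≃-reflexive (cong (λ i → mkℚᵘ i (e + d * suc e)) (sym (ℤP.pos-* a b))))
               (ℚᵘP.≃-sym (toℚᵘ-frac (a * b) (e + d * suc e))))))

frac-cross : ∀ {a b d e} .{{_ : NonZero d}} .{{_ : NonZero e}} →
             a * e ≡ b * d → frac a d ≡ frac b e
frac-cross {a} {b} {suc d} {suc e} ae≡bd = ℚP.fromℚᵘ-cong {mkℚᵘ (+ a) d} {mkℚᵘ (+ b) e} (*≡* (begin
    + a ℤ.* + suc e   ≡⟨ ℤP.pos-* a (suc e) ⟨
    + (a * suc e)     ≡⟨ cong +_ ae≡bd ⟩
    + (b * suc d)     ≡⟨ ℤP.pos-* b (suc d) ⟩
    + b ℤ.* + suc d   ∎))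

∏-frac : ∀ (h : ℕ → ℕ) ks →
  foldr _*ℚ_ 1ℚ (map (λ k → frac (h k) k) ks) ≡ frac (product (map h ks)) (product ks)
∏-frac h []       = refl
∏-frac h (k ∷ ks) = trans (cong (frac (h k) k *ℚ_) (∏-frac h ks)) (frac-* (h k) _ k _)

-- 𝒞_{n+m,m} for n = s + 1

module Ballot (s m : ℕ) where

  -- A path from (0, -2m) to (n, n) has T steps; its reflection starts at (-2m-1, 1)
  -- and makes x₁ right and s up steps.
  n k N x₁ T : ℕ
  n  = suc s
  k  = 2 * m
  N  = n + m
  x₁ = suc (n + k)
  T  = n + (n + k)

  𝒞-reflection : 𝒞 N m + (x₁ + s) C x₁ ≡ T C n
  𝒞-reflection = begin
      𝒞 N m + (x₁ + s) C x₁
    ≡⟨ cong (λ c → 𝒞 N m + c) reflected ⟨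
      goodPaths (2 * N) a b + paths (2 * N) (reflect a) b
    ≡⟨ reflection-principle (2 * N) (+ 0) (- + k) b ℤP.neg-≤-pos ℤP.≤-refl ⟩
      paths (2 * N) a b
    ≡⟨ direct ⟩
      T C n ∎
    where
    a b : Point
    a = (+ 0 , - + k)
    b = (+ (N ∸ m) , + (N ∸ m))
    N∸m≡n : + (N ∸ m) ≡ + n
    N∸m≡n = cong +_ (ℕP.m+n∸n≡m n m)
    -j+[i+j]≡i : ∀ i j → - j ℤ.+ (i ℤ.+ j) ≡ i
    -j+[i+j]≡i = ℤ-Ring.solve-∀
    [-j-1]+[1+i+j]≡i : ∀ i j → (- j ℤ.- + 1) ℤ.+ ((+ 1 ℤ.+ i) ℤ.+ j) ≡ i
    [-j-1]+[1+i+j]≡i = ℤ-Ring.solve-∀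
    2N≡T : ∀ s m → 2 * (1 + s + m) ≡ (1 + s) + ((1 + s) + 2 * m)
    2N≡T = ℕ-Ring.solve-∀
    2N≡x₁+s : ∀ s m → 2 * (1 + s + m) ≡ (1 + ((1 + s) + 2 * m)) + s
    2N≡x₁+s = ℕ-Ring.solve-∀
    direct : paths (2 * N) a b ≡ T C n
    direct = trans (cong (λ L → paths L a b) (2N≡T s m))
      (paths≡C n (n + k) N∸m≡n (trans N∸m≡n (sym (-j+[i+j]≡i (+ n) (+ k)))))
    reflected : paths (2 * N) (reflect a) b ≡ (x₁ + s) C x₁
    reflected = trans (cong (λ L → paths L (reflect a) b) (2N≡x₁+s s m))
      (paths≡C x₁ s (trans N∸m≡n (sym ([-j-1]+[1+i+j]≡i (+ n) (+ k)))) N∸m≡n)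

  𝒞-closed-form : 𝒞 N m * (n ! * x₁ !) ≡ suc k * T !
  𝒞-closed-form = ℕP.+-cancelʳ-≡ (T ! * n) _ _ (begin
      𝒞 N m * K + T ! * n
    ≡⟨ cong (λ c → 𝒞 N m * K + c) reflected-term ⟨
      𝒞 N m * K + B₁ * K
    ≡⟨ ℕP.*-distribʳ-+ K (𝒞 N m) B₁ ⟨
      (𝒞 N m + B₁) * K
    ≡⟨ cong (_* K) 𝒞-reflection ⟩
      B₀ * K
    ≡⟨ regroup₀ B₀ (n !) ((n + k) !) x₁ ⟩
      B₀ * (n ! * (n + k) !) * x₁
    ≡⟨ cong (_* x₁) ([x+y]Cx*[x!*y!]≡[x+y]! n (n + k)) ⟩
      T ! * x₁
    ≡⟨ split (T !) s k ⟩
      suc k * T ! + T ! * n ∎)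
    where
    B₀ B₁ K : ℕ
    B₀ = T C n
    B₁ = (x₁ + s) C x₁
    K  = n ! * x₁ !
    regroup₀ : ∀ b f g x → b * (f * (x * g)) ≡ b * (f * g) * x
    regroup₀ = ℕ-Ring.solve-∀
    regroup₁ : ∀ b f g s → b * (((1 + s) * f) * g) ≡ b * (g * f) * (1 + s)
    regroup₁ = ℕ-Ring.solve-∀
    split : ∀ t s k → t * (1 + ((1 + s) + k)) ≡ (1 + k) * t + t * (1 + s)
    split = ℕ-Ring.solve-∀
    x₁+s≡T : ∀ s k → (1 + ((1 + s) + k)) + s ≡ (1 + s) + ((1 + s) + k)
    x₁+s≡T = ℕ-Ring.solve-∀
    reflected-term : B₁ * K ≡ T ! * n
    reflected-term = begin
        B₁ * K                 ≡⟨ regroup₁ B₁ (s !) (x₁ !) s ⟩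
        B₁ * (x₁ ! * s !) * n  ≡⟨ cong (_* n) ([x+y]Cx*[x!*y!]≡[x+y]! x₁ s) ⟩
        (x₁ + s) ! * n         ≡⟨ cong (λ t → t ! * n) (x₁+s≡T s k) ⟩
        T ! * n                ∎

  Q₁ P₁ Q₂ P₂ : ℕ
  Q₁ = product (range 1 m)
  P₁ = product (map (N ∸_) (range 1 m))
  Q₂ = product (range (m + 2) N)
  P₂ = product (map (λ j → N + j) (range (m + 2) N))

  Q₁≡m! : Q₁ ≡ m !
  Q₁≡m! = trans (sym (ℕP.*-identityˡ Q₁)) (product-range {0} {m} z≤n)

  [1+m]!*Q₂≡N! : suc m ! * Q₂ ≡ N !
  [1+m]!*Q₂≡N! = trans (cong (λ c → suc m ! * product (range c N)) (ℕP.+-comm m 2))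
                       (product-range (s≤s (ℕP.m≤n+m m s)))

  s!*P₁≡[s+m]! : s ! * P₁ ≡ (s + m) !
  s!*P₁≡[s+m]! = trans (cong (λ ks → s ! * product ks) (map-applyUpTo (λ i → 1 + i) (N ∸_) m))
                       (!*product-descending s m)

  x₁!*P₂≡T! : x₁ ! * P₂ ≡ T !
  x₁!*P₂≡T! = trans (cong (λ ks → x₁ ! * product ks) shifted)
                    (product-range (s≤s (ℕP.m≤n+m (n + k) s)))
    where
    N+[m+2]≡1+x₁ : ∀ s m → (1 + s + m) + (m + 2) ≡ 1 + (1 + ((1 + s) + 2 * m))
    N+[m+2]≡1+x₁ = ℕ-Ring.solve-∀
    N+N≡T : ∀ s m → (1 + s + m) + (1 + s + m) ≡ (1 + s) + ((1 + s) + 2 * m)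
    N+N≡T = ℕ-Ring.solve-∀
    shifted : map (λ j → N + j) (range (m + 2) N) ≡ range (suc x₁) T
    shifted = trans (map-+-range N (m + 2) N) (cong₂ range (N+[m+2]≡1+x₁ s m) (N+N≡T s m))

  denominator≡n*N! : n * (m + 1) * Q₁ * Q₂ ≡ n * N !
  denominator≡n*N! = begin
      n * (m + 1) * Q₁ * Q₂    ≡⟨ cong (λ q → n * (m + 1) * q * Q₂) Q₁≡m! ⟩
      n * (m + 1) * m ! * Q₂   ≡⟨ regroup n m (m !) Q₂ ⟩
      n * (suc m ! * Q₂)       ≡⟨ cong (n *_) [1+m]!*Q₂≡N! ⟩
      n * N !                  ∎
    where
    regroup : ∀ n m f q → n * (m + 1) * f * q ≡ n * ((1 + m) * f * q)
    regroup = ℕ-Ring.solve-∀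

  𝒞-cross-multiplied : 𝒞 N m * (n * N !) ≡ N * (2 * m + 1) * P₁ * P₂ * 1
  𝒞-cross-multiplied = ℕP.*-cancelʳ-≡ _ _ (s ! * x₁ !) {{ℕP._!*_!≢0 s x₁}} (begin
      𝒞 N m * (n * N !) * (s ! * x₁ !)
    ≡⟨ regroupˡ (𝒞 N m) s (s !) (x₁ !) (N !) ⟩
      𝒞 N m * (n ! * x₁ !) * N !
    ≡⟨ cong (_* N !) 𝒞-closed-form ⟩
      suc k * T ! * (N * (s + m) !)
    ≡⟨ cong₂ (λ t f → suc k * t * (N * f)) x₁!*P₂≡T! s!*P₁≡[s+m]! ⟨
      suc k * (x₁ ! * P₂) * (N * (s ! * P₁))
    ≡⟨ regroupʳ m N (s !) (x₁ !) P₁ P₂ ⟩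
      N * (2 * m + 1) * P₁ * P₂ * 1 * (s ! * x₁ !) ∎)
    where
    regroupˡ : ∀ c s f g F → c * ((1 + s) * F) * (f * g) ≡ c * (((1 + s) * f) * g) * F
    regroupˡ = ℕ-Ring.solve-∀
    regroupʳ : ∀ m N f g p₁ p₂ →
      (1 + 2 * m) * (g * p₂) * (N * (f * p₁)) ≡ N * (2 * m + 1) * p₁ * p₂ * 1 * (f * g)
    regroupʳ = ℕ-Ring.solve-∀

  product-formula : frac (𝒞 N m) 1
    ≡ (frac (N * (2 * m + 1)) (n * (m + 1)) *ℚ ∏[ 1 to m ] (λ j → frac (N ∸ j) j))
        *ℚ ∏[ m + 2 to N ] (λ j → frac (N + j) j)
  product-formula = begin
      frac (𝒞 N m) 1
    ≡⟨ frac-cross {𝒞 N m} {u * P₁ * P₂} {{_}} {{n*N!≢0}} 𝒞-cross-multiplied ⟩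
      frac (u * P₁ * P₂) (n * N !)
    ≡⟨ cong (frac (u * P₁ * P₂)) denominator≡n*N! ⟨
      frac (u * P₁ * P₂) (v * Q₁ * Q₂)
    ≡⟨ frac-* (u * P₁) P₂ (v * Q₁) Q₂ ⟨
      frac (u * P₁) (v * Q₁) *ℚ frac P₂ Q₂
    ≡⟨ cong (_*ℚ frac P₂ Q₂) (frac-* u P₁ v Q₁) ⟨
      (frac u v *ℚ frac P₁ Q₁) *ℚ frac P₂ Q₂
    ≡⟨ cong₂ (λ x y → (frac u v *ℚ x) *ℚ y)
             (∏-frac (N ∸_) (range 1 m)) (∏-frac (λ j → N + j) (range (m + 2) N)) ⟨
      (frac u v *ℚ ∏[ 1 to m ] (λ j → frac (N ∸ j) j)) *ℚ ∏[ m + 2 to N ] (λ j → frac (N + j) j) ∎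
    where
    u v : ℕ
    u = N * (2 * m + 1)
    v = n * (m + 1)
    n*N!≢0 : NonZero (n * N !)
    n*N!≢0 = ℕP.m*n≢0 n (N !) {{_}} {{ℕP._!≢0 N}}

corollary7p3 : (n m : ℕ) → 1 ≤ m → m ≤ n →
    frac (𝒞 (n + m) m) 1
      ≡ (frac ((n + m) * (2 * m + 1)) (n * (m + 1))
          *ℚ ∏[ 1 to m ] (λ k → frac (n + m ∸ k) k))
          *ℚ ∏[ m + 2 to n + m ] (λ k → frac (n + m + k) k)
-- For n = 0 the right-hand side is 0 (as frac _ 0 = 0) while 𝒞 m m = 1: the hypotheses
-- only serve to exclude this case.
corollary7p3 zero    m 1≤m m≤0 = contradiction (ℕP.≤-trans 1≤m m≤0) λ ()
corollary7p3 (suc s) m _   _   = Ballot.product-formula s m
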